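{- There exists a $(12,3,1)$-LDF.
   Context: Let $k\geq 2$ and $v$ be positive integers, and let $\mathbb{Q}[\mathbb{Z}_v]$ be the group ring of $\mathbb{Z}_v$ over the rationals (formal sums $\sum_{g\in\mathbb{Z}_v}a_g g$, $a_g\in\mathbb{Q}$, added coefficientwise). For an ordered $k$-tuple $B=(b_0,\dots,b_{k-1})$ of (not necessarily distinct) elements of $\mathbb{Z}_v$ define $$\Delta^*B=\sum_{0\leq s_1<s_2<k}\ \sum_{0\leq \ell<s_2-s_1}\frac{1}{s_2-s_1}\Big[(b_{s_2}-b_{s_1}+\ell)+(b_{s_1}-b_{s_2}-\ell-1)\Big]\in\mathbb{Q}[\mathbb{Z}_v],$$ where the bracketed terms are group elements of $\mathbb{Z}_v$ and $\frac{1}{s_2-s_1}\in\mathbb{Q}$ is their coefficient. A collection $\mathcal B$ of such ordered $k$-tuples is a $(v,k,\lambda)$-layered difference family (LDF) if $\sum_{B\in\mathcal B}\Delta^*B=\lambda\sum_{g\in\mathbb{Z}_v}g$. -}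

module Defs where

open import Data.Nat as ℕ using (ℕ; zero; suc; NonZero; _<?_)
open import Data.Integer as ℤ using (ℤ; +_)
open import Data.Integer.DivMod using (_%ℕ_)
open import Data.Fin using (Fin; toℕ)
open import Data.Vec using (Vec; lookup)
open import Data.List using (List; []; _∷_; foldr; map; allFin; upTo)
open import Data.Rational as ℚ using (ℚ; 0ℚ; 1ℚ; _/_)
open import Relation.Nullary using (yes; no)

-- Elements of the group ring ℚ[ℤ_v] are represented by their coefficient
-- functions  Fin v → ℚ  (ℤ_v = {0,…,v-1} via Fin v).
GroupRing : ℕ → Set
GroupRing v = Fin v → ℚ

Σℚ : {A : Set} → List A → (A → ℚ) → ℚ
Σℚ xs f = foldr (λ x acc → f x ℚ.+ acc) 0ℚ xs

[_]ᵥ : ∀ {v} .{{_ : NonZero v}} → ℤ → GroupRing v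
[_]ᵥ {v} x g with (x %ℕ v) ℕ.≟ toℕ g
... | yes _ = 1ℚ
... | no _  = 0ℚ

ι : ∀ {v} → Fin v → ℤ
ι g = + toℕ g

-- Δ* B for an ordered k-tuple B = (b_0,…,b_{k-1}) of elements of ℤ_v:
-- Σ_{0≤s1<s2<k} Σ_{0≤ℓ<s2-s1} 1/(s2-s1) [ (b_{s2}-b_{s1}+ℓ) + (b_{s1}-b_{s2}-ℓ-1) ]
Δ* : ∀ {v k} .{{_ : NonZero v}} → Vec (Fin v) k → GroupRing v
Δ* {v} {k} B g =
  Σℚ (allFin k) λ s₁ → Σℚ (allFin k) λ s₂ → term s₁ s₂
  where
  bterm : (s₁ s₂ : Fin k) (d : ℕ) .{{_ : NonZero d}} → ℚ
  bterm s₁ s₂ d = Σℚ (upTo d) λ ℓ →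
    (+ 1 / d) ℚ.* ( [ (ι (lookup B s₂) ℤ.- ι (lookup B s₁)) ℤ.+ + ℓ ]ᵥ g
                  ℚ.+ [ ((ι (lookup B s₁) ℤ.- ι (lookup B s₂)) ℤ.- + ℓ) ℤ.- + 1 ]ᵥ g )
  term : Fin k → Fin k → ℚ
  term s₁ s₂ with toℕ s₁ <? toℕ s₂
  ... | no _  = 0ℚ
  ... | yes _ with toℕ s₂ ℕ.∸ toℕ s₁
  ...   | zero  = 0ℚ   -- impossible when s₁ < s₂
  ...   | suc m = bterm s₁ s₂ (suc m)

ΣGR : ∀ {v} → List (GroupRing v) → GroupRing v
ΣGR xs g = Σℚ xs (λ x → x g)

constGR : ∀ {v} → ℕ → GroupRing v
constGR λ' g = + λ' / 1

-- A collection 𝓑 (a list, so repetitions are allowed) of ordered k-tuples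
-- is a (v,k,λ)-LDF iff Σ_{B∈𝓑} Δ*B = λ Σ_{g∈ℤ_v} g.
IsLDF : (v k λ' : ℕ) .{{_ : NonZero v}} → List (Vec (Fin v) k) → Set
IsLDF v k λ' 𝓑 = ∀ (g : Fin v) → ΣGR (map Δ* 𝓑) g ≡ constGR λ' g
  where open import Relation.Binary.PropositionalEquality using (_≡_)

{-# OPTIONS --safe #-}
module Submission where

open import Defs
open import Data.Nat using (ℕ; NonZero)
open import Data.Fin using (Fin; #_)
open import Data.Fin.Properties using (all?)
open import Data.Vec using (Vec; []; _∷_)
open import Data.List using (List; []; _∷_; map)
open import Data.Product using (∃; _,_)
open import Data.Rational.Properties using (_≟_)
open import Relation.Nullary.Decidable using (Dec; from-yes)

isLDF? : (v k λ' : ℕ) .{{_ : NonZero v}} (𝓑 : List (Vec (Fin v) k)) →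
         Dec (IsLDF v k λ' 𝓑)
isLDF? v k λ' 𝓑 = all? λ g → ΣGR (map Δ* 𝓑) g ≟ constGR λ' g

-- In Δ* of either tuple the consecutive pairs give coefficient 1 to 2,9,8,3
-- (resp. 4,7,6,5) and the pair (b₀,b₂) gives 1/2 to each of 10,11,1,0, so the
-- sum puts coefficient 1 on every residue.
ldf-12-3-1 : List (Vec (Fin 12) 3)
ldf-12-3-1 = (# 0 ∷ # 2 ∷ # 10 ∷ []) ∷ (# 0 ∷ # 4 ∷ # 10 ∷ []) ∷ []

lemma3p2 : ∃ λ (𝓑 : List (Vec (Fin 12) 3)) → IsLDF 12 3 1 𝓑
lemma3p2 = ldf-12-3-1 , from-yes (isLDF? 12 3 1 ldf-12-3-1)
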